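{- Let $e\geq 3$ and let $n\geq 2e$ be an integer with $n\equiv 0$ or $n\equiv 1 \pmod{2e}$. Then there exists an $e$-star system of order $n$ which is either $(n-1)$-block-colourable or $n$-block-colourable.
   Context: For an integer $e\ge 1$, an $e$-star is a copy of the complete bipartite graph $K_{1,e}$. An $e$-star system of order $n$ is a pair $(V,\mathcal{B})$ where $|V|=n$ and $\mathcal{B}$ is a set of $e$-stars (subgraphs of the complete graph $K_n$ on $V$) whose edge sets partition the edge set of $K_n$; the elements of $\mathcal B$ are called blocks. A block-colouring of such a system is a partition of $\mathcal{B}$ into colour classes such that the blocks in each colour class are pairwise vertex-disjoint. The system is $k$-block-colourable if it admits a block-colouring with $k$ colour classes. -}

module Defs where

open import Data.Nat using (ℕ)
open import Data.Fin using (Fin)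
open import Data.Product using (Σ; ∃; _×_)
open import Data.Sum using (_⊎_)
open import Relation.Binary.PropositionalEquality using (_≡_; _≢_)
open import Relation.Nullary using (¬_)
open import Function.Definitions using (Injective; Surjective)

record Star (n e : ℕ) : Set where
  field
    centre       : Fin n
    leaf         : Fin e → Fin n
    leaf-inj     : Injective _≡_ _≡_ leaf
    leaf≢centre  : ∀ i → leaf i ≢ centre
open Star public

IsLeaf : ∀ {n e} → Star n e → Fin n → Set
IsLeaf s x = ∃ λ i → leaf s i ≡ x

IsVertex : ∀ {n e} → Star n e → Fin n → Set
IsVertex s x = (x ≡ centre s) ⊎ IsLeaf s x

HasEdge : ∀ {n e} → Star n e → Fin n → Fin n → Set
HasEdge s u v = (u ≡ centre s × IsLeaf s v) ⊎ (v ≡ centre s × IsLeaf s u)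

IsStarSystem : (n e m : ℕ) → (Fin m → Star n e) → Set
IsStarSystem n e m B =
  ∀ (u v : Fin n) → u ≢ v →
    Σ (Fin m) λ i → HasEdge (B i) u v × (∀ j → HasEdge (B j) u v → j ≡ i)

record StarSystem (n e : ℕ) : Set where
  field
    nblocks   : ℕ
    block     : Fin nblocks → Star n e
    partition : IsStarSystem n e nblocks block
open StarSystem public

VertexDisjoint : ∀ {n e} → Star n e → Star n e → Set
VertexDisjoint s t = ∀ x → IsVertex s x → ¬ IsVertex t x

-- A block-colouring with k colour classes: a partition of the blocks into
-- k (nonempty) classes, given by a surjective colour map, such that
-- distinct blocks of the same colour are vertex-disjoint.
IsBlockColouring : ∀ {n e} (S : StarSystem n e) (k : ℕ) →
                   (Fin (nblocks S) → Fin k) → Set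
IsBlockColouring S k col =
  Surjective _≡_ _≡_ col ×
  (∀ i j → i ≢ j → col i ≡ col j → VertexDisjoint (block S i) (block S j))

BlockColourable : ∀ {n e} → StarSystem n e → ℕ → Set
BlockColourable S k = ∃ λ (col : Fin (nblocks S) → Fin k) → IsBlockColouring S k col

{-# OPTIONS --safe #-}
-- Write n = 2ek + s with s ∈ {0, 1} and put N = 2ek + 2s − 1, so that n = N + 1 − s. The vertices
-- are Z_N, together with one more vertex ∞ when s = 0. The differences s, s + 1, …, N − s fill k rows
-- of 2e consecutive values, and negation modulo N maps row j onto row k − 1 − j with the two halves
-- of every row exchanged (when s = 0, the difference N pairs with the difference 0 and stands for ∞).
-- The block B(i, j) is the e-star centred at i whose leaves are i plus the upper half of row j, so
-- each edge {u, v} lies in exactly one block: the one centred at the endpoint from which the other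
-- lies in an upper half. Colour B(i, j) with c = i + (j + 1)e. Its centre is c − (j + 1)e and its
-- leaves are c + s + je + t for t < e, so the row j of a block of colour c containing a vertex x
-- can be read off from x − c; hence blocks of equal colour are vertex-disjoint, with N colours.
module Submission where

open import Defs
open import Data.Nat
open import Data.Nat.Properties
open import Data.Nat.DivMod
open import Data.Nat.Divisibility using (_∣_; divides; divides-refl)
open import Data.Nat.Tactic.RingSolver using (solve-∀)
open import Data.Fin using (Fin; toℕ; fromℕ<; combine; remQuot)
open import Data.Fin.Properties using (toℕ-fromℕ<; toℕ-injective; toℕ<n; fromℕ<-injective; remQuot-combine; combine-remQuot)
open import Data.Product as Product using (∃; ∃₂; _×_; _,_; proj₁; proj₂; uncurry)
open import Data.Sum as Sum using (_⊎_; inj₁; inj₂)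
open import Function using (_∘_)
open import Function.Definitions using (Surjective)
open import Relation.Nullary using (¬_; Dec; yes; no; contradiction)
open import Relation.Binary.PropositionalEquality

module Residues (N : ℕ) .{{_ : NonZero N}} where

  infixl 6 _+ₘ_ _-ₘ_

  _+ₘ_ : ℕ → ℕ → ℕ
  x +ₘ a = (x + a) % N

  _-ₘ_ : ℕ → ℕ → ℕ
  y -ₘ x = (y + (N ∸ x)) % N

  +ₘ<N : ∀ x a → x +ₘ a < N
  +ₘ<N x a = m%n<n (x + a) N

  -ₘ<N : ∀ y x → y -ₘ x < N
  -ₘ<N y x = m%n<n (y + (N ∸ x)) N

  private
    [m+n%N]%N≡[m+n]%N : ∀ a b → (a + b % N) % N ≡ (a + b) % N
    [m+n%N]%N≡[m+n]%N a b = begin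
      (a + b % N) % N           ≡⟨ %-distribˡ-+ a (b % N) N ⟩
      (a % N + b % N % N) % N   ≡⟨ cong (λ z → (a % N + z) % N) (m%n%n≡m%n b N) ⟩
      (a % N + b % N) % N       ≡⟨ %-distribˡ-+ a b N ⟨
      (a + b) % N               ∎
      where open ≡-Reasoning

    [m%N+n]%N≡[m+n]%N : ∀ a b → (a % N + b) % N ≡ (a + b) % N
    [m%N+n]%N≡[m+n]%N a b = begin
      (a % N + b) % N   ≡⟨ cong (_% N) (+-comm (a % N) b) ⟩
      (b + a % N) % N   ≡⟨ [m+n%N]%N≡[m+n]%N b a ⟩
      (b + a) % N       ≡⟨ cong (_% N) (+-comm b a) ⟩
      (a + b) % N       ∎
      where open ≡-Reasoning

  +ₘ-assoc : ∀ x a b → (x +ₘ a) +ₘ b ≡ x +ₘ (a + b)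
  +ₘ-assoc x a b = trans ([m%N+n]%N≡[m+n]%N (x + a) b) (cong (_% N) (+-assoc x a b))

  +ₘ-identityʳ : ∀ {x} → x < N → x +ₘ 0 ≡ x
  +ₘ-identityʳ {x} x<N = trans (cong (_% N) (+-identityʳ x)) (m<n⇒m%n≡m x<N)

  m+ₘN≡m : ∀ {x} → x < N → x +ₘ N ≡ x
  m+ₘN≡m {x} x<N = trans ([m+n]%n≡m%n x N) (m<n⇒m%n≡m x<N)

  m+ₘ[n-ₘm]≡n : ∀ {x y} → x ≤ N → y < N → x +ₘ (y -ₘ x) ≡ y
  m+ₘ[n-ₘm]≡n {x} {y} x≤N y<N = begin
    (x + (y + (N ∸ x)) % N) % N   ≡⟨ [m+n%N]%N≡[m+n]%N x (y + (N ∸ x)) ⟩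
    (x + (y + (N ∸ x))) % N       ≡⟨ cong (_% N) x+[y+[N∸x]]≡y+N ⟩
    (y + N) % N                   ≡⟨ [m+n]%n≡m%n y N ⟩
    y % N                         ≡⟨ m<n⇒m%n≡m y<N ⟩
    y                             ∎
    where
      open ≡-Reasoning
      x+[y+[N∸x]]≡y+N : x + (y + (N ∸ x)) ≡ y + N
      x+[y+[N∸x]]≡y+N = begin
        x + (y + (N ∸ x))   ≡⟨ cong (x +_) (+-comm y (N ∸ x)) ⟩
        x + ((N ∸ x) + y)   ≡⟨ +-assoc x (N ∸ x) y ⟨
        (x + (N ∸ x)) + y   ≡⟨ cong (_+ y) (m+[n∸m]≡n x≤N) ⟩
        N + y               ≡⟨ +-comm N y ⟩
        y + N               ∎

  -ₘ-unique : ∀ {x y d} → x ≤ N → d < N → x +ₘ d ≡ y → y -ₘ x ≡ d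
  -ₘ-unique {x} {d = d} x≤N d<N refl = begin
    ((x + d) % N + (N ∸ x)) % N   ≡⟨ [m%N+n]%N≡[m+n]%N (x + d) (N ∸ x) ⟩
    (x + d + (N ∸ x)) % N         ≡⟨ cong (_% N) x+d+[N∸x]≡d+N ⟩
    (d + N) % N                   ≡⟨ [m+n]%n≡m%n d N ⟩
    d % N                         ≡⟨ m<n⇒m%n≡m d<N ⟩
    d                             ∎
    where
      open ≡-Reasoning
      x+d+[N∸x]≡d+N : x + d + (N ∸ x) ≡ d + N
      x+d+[N∸x]≡d+N = begin
        x + d + (N ∸ x)     ≡⟨ cong (_+ (N ∸ x)) (+-comm x d) ⟩
        d + x + (N ∸ x)     ≡⟨ +-assoc d x (N ∸ x) ⟩
        d + (x + (N ∸ x))   ≡⟨ cong (d +_) (m+[n∸m]≡n x≤N) ⟩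
        d + N               ∎

  [m+ₘn]-ₘm≡n : ∀ {x d} → x ≤ N → d < N → (x +ₘ d) -ₘ x ≡ d
  [m+ₘn]-ₘm≡n x≤N d<N = -ₘ-unique x≤N d<N refl

  +ₘ-cancelˡ : ∀ x {a b} → x ≤ N → a < N → b < N → x +ₘ a ≡ x +ₘ b → a ≡ b
  +ₘ-cancelˡ x x≤N a<N b<N x+a≡x+b =
    trans (sym ([m+ₘn]-ₘm≡n x≤N a<N)) (-ₘ-unique x≤N b<N (sym x+a≡x+b))

  +ₘ-cancelʳ : ∀ {x y} a → x < N → y < N → x +ₘ a ≡ y +ₘ a → x ≡ y
  +ₘ-cancelʳ {x} {y} a x<N y<N x+a≡y+a =
    +ₘ-cancelˡ (a % N) (<⇒≤ (m%n<n a N)) x<N y<N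
      (trans (sym (+ₘ≡%+ₘ x)) (trans x+a≡y+a (+ₘ≡%+ₘ y)))
    where
      +ₘ≡%+ₘ : ∀ z → z +ₘ a ≡ (a % N) +ₘ z
      +ₘ≡%+ₘ z = trans (cong (_% N) (+-comm z a)) (sym ([m%N+n]%N≡[m+n]%N a z))

  [m+ₘn]+ₘ[N∸n]≡m : ∀ {x a} → x < N → a ≤ N → (x +ₘ a) +ₘ (N ∸ a) ≡ x
  [m+ₘn]+ₘ[N∸n]≡m {x} {a} x<N a≤N =
    trans (+ₘ-assoc x a (N ∸ a)) (trans (cong (x +ₘ_) (m+[n∸m]≡n a≤N)) (m+ₘN≡m x<N))

  m-ₘ[m+ₘn]≡N∸n : ∀ {x a} → x < N → 0 < a → a ≤ N → x -ₘ (x +ₘ a) ≡ N ∸ a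
  m-ₘ[m+ₘn]≡N∸n {x} {a} x<N 0<a a≤N =
    -ₘ-unique (<⇒≤ (+ₘ<N x a)) (∸-monoʳ-< 0<a a≤N) ([m+ₘn]+ₘ[N∸n]≡m x<N a≤N)

[m*n+o]/n≡m : ∀ m n {o} .{{_ : NonZero n}} → o < n → (m * n + o) / n ≡ m
[m*n+o]/n≡m m n {o} o<n = begin
  (m * n + o) / n     ≡⟨ +-distrib-/-∣ˡ o (divides-refl m) ⟩
  m * n / n + o / n   ≡⟨ cong₂ _+_ (m*n/n≡m m n) (m<n⇒m/n≡0 o<n) ⟩
  m + 0               ≡⟨ +-identityʳ m ⟩
  m                   ∎
  where open ≡-Reasoning

[m*n+o]%n≡o : ∀ m n {o} .{{_ : NonZero n}} → o < n → (m * n + o) % n ≡ o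
[m*n+o]%n≡o m n o<n = trans (%-remove-+ˡ _ (divides-refl m)) (m<n⇒m%n≡m o<n)

module Layout (s k E N : ℕ) .{{_ : NonZero E}} (N+1≡kE+2s : N + 1 ≡ k * E + (s + s)) where

  pos : ℕ → ℕ → ℕ
  pos j r = s + (j * E + r)

  row : ℕ → ℕ
  row d = (d ∸ s) / E

  column : ℕ → ℕ
  column d = (d ∸ s) % E

  column<E : ∀ d → column d < E
  column<E d = m%n<n (d ∸ s) E

  row-pos : ∀ j {r} → r < E → row (pos j r) ≡ j
  row-pos j r<E = trans (cong (_/ E) (m+n∸m≡n s _)) ([m*n+o]/n≡m j E r<E)

  column-pos : ∀ j {r} → r < E → column (pos j r) ≡ r
  column-pos j r<E = trans (cong (_% E) (m+n∸m≡n s _)) ([m*n+o]%n≡o j E r<E)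

  pos-row-column : ∀ {d} → s ≤ d → pos (row d) (column d) ≡ d
  pos-row-column {d} s≤d = begin
    s + (row d * E + column d)   ≡⟨ cong (s +_) (+-comm (row d * E) (column d)) ⟩
    s + (column d + row d * E)   ≡⟨ cong (s +_) (m≡m%n+[m/n]*n (d ∸ s) E) ⟨
    s + (d ∸ s)                  ≡⟨ m+[n∸m]≡n s≤d ⟩
    d                            ∎
    where open ≡-Reasoning

  0<column⇒s≤ : ∀ {d} → 0 < column d → s ≤ d
  0<column⇒s≤ {d} 0<column with s ≤? d
  ... | yes s≤d = s≤d
  ... | no s≰d = contradiction column≡0 (>⇒≢ 0<column)
    where
      column≡0 : column d ≡ 0
      column≡0 = trans (cong (_% E) (m≤n⇒m∸n≡0 (<⇒≤ (≰⇒> s≰d)))) (m<n⇒m%n≡m (>-nonZero⁻¹ E))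

  pos-mirror : ∀ {j r} → j < k → r < E → pos (k ∸ suc j) (E ∸ suc r) + pos j r ≡ N
  pos-mirror {j} {r} j<k r<E = suc-injective (begin
    suc (pos a b + pos j r)               ≡⟨ regroup s j r a b E ⟩
    (suc r + b) + (a + j) * E + (s + s)   ≡⟨ cong (λ x → x + (a + j) * E + (s + s)) (m+[n∸m]≡n r<E) ⟩
    E + (a + j) * E + (s + s)             ≡⟨ collect s j a E ⟩
    (suc j + a) * E + (s + s)             ≡⟨ cong (λ x → x * E + (s + s)) (m+[n∸m]≡n j<k) ⟩
    k * E + (s + s)                       ≡⟨ N+1≡kE+2s ⟨
    N + 1                                 ≡⟨ +-comm N 1 ⟩
    suc N                                 ∎)
    where
      open ≡-Reasoning
      a = k ∸ suc j
      b = E ∸ suc r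
      regroup : ∀ s j r a b E →
                suc ((s + (a * E + b)) + (s + (j * E + r))) ≡ (suc r + b) + (a + j) * E + (s + s)
      regroup = solve-∀
      collect : ∀ s j a E → E + (a + j) * E + (s + s) ≡ (suc j + a) * E + (s + s)
      collect = solve-∀

  N∸pos : ∀ {j r} → j < k → r < E → N ∸ pos j r ≡ pos (k ∸ suc j) (E ∸ suc r)
  N∸pos {j} {r} j<k r<E = trans (cong (_∸ pos j r) (sym (pos-mirror j<k r<E))) (m+n∸n≡m _ (pos j r))

  pos≤N : ∀ {j r} → j < k → r < E → pos j r ≤ N
  pos≤N {j} {r} j<k r<E =
    subst (pos j r ≤_) (pos-mirror j<k r<E) (m≤n+m (pos j r) (pos (k ∸ suc j) (E ∸ suc r)))

  N≤s+kE : s ≤ 1 → N ≤ s + k * E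
  N≤s+kE s≤1 = +-cancelʳ-≤ 1 N (s + k * E) (begin
    N + 1               ≡⟨ N+1≡kE+2s ⟩
    k * E + (s + s)     ≤⟨ +-monoʳ-≤ (k * E) (+-monoʳ-≤ s s≤1) ⟩
    k * E + (s + 1)     ≡⟨ +-assoc (k * E) s 1 ⟨
    k * E + s + 1       ≡⟨ cong (_+ 1) (+-comm (k * E) s) ⟩
    s + k * E + 1       ∎)
    where open ≤-Reasoning

  row<k : s ≤ 1 → ∀ {d} → s ≤ d → d < N → row d < k
  row<k s≤1 {d} s≤d d<N = m<n*o⇒m/o<n (+-cancelˡ-< s (d ∸ s) (k * E) (begin-strict
    s + (d ∸ s)   ≡⟨ m+[n∸m]≡n s≤d ⟩
    d             <⟨ d<N ⟩
    N             ≤⟨ N≤s+kE s≤1 ⟩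
    s + k * E     ∎))
    where open ≤-Reasoning

  column-mirror : s ≤ 1 → ∀ {d} → s ≤ d → d < N → column (N ∸ d) ≡ E ∸ suc (column d)
  column-mirror s≤1 {d} s≤d d<N = begin
    column (N ∸ d)                         ≡⟨ cong (λ x → column (N ∸ x)) (pos-row-column s≤d) ⟨
    column (N ∸ pos j (column d))          ≡⟨ cong column (N∸pos (row<k s≤1 s≤d d<N) (column<E d)) ⟩
    column (pos (k ∸ suc j) (E ∸ suc c))   ≡⟨ column-pos (k ∸ suc j) (∸-monoʳ-< z<s (column<E d)) ⟩
    E ∸ suc c                              ∎
    where
      open ≡-Reasoning
      j = row d
      c = column d

remQuot-injective : ∀ {m} n {i j : Fin (m * n)} → remQuot {m} n i ≡ remQuot n j → i ≡ j
remQuot-injective {m} n {i} {j} eq =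
  trans (sym (combine-remQuot {m} n i)) (trans (cong (uncurry combine) eq) (combine-remQuot {m} n j))

pair-toℕ : ∀ {m n} → Fin m × Fin n → ℕ × ℕ
pair-toℕ = Product.map toℕ toℕ

pair-toℕ-injective : ∀ {m n} {p q : Fin m × Fin n} → pair-toℕ p ≡ pair-toℕ q → p ≡ q
pair-toℕ-injective {p = _ , _} {q = _ , _} eq =
  cong₂ _,_ (toℕ-injective (cong proj₁ eq)) (toℕ-injective (cong proj₂ eq))

module Construction (e k s N n : ℕ) (1≤e : 1 ≤ e) (1≤k : 1 ≤ k) (s≤1 : s ≤ 1)
                    (N+1≡2ek+2s : N + 1 ≡ k * (e + e) + (s + s)) (n+s≡N+1 : n + s ≡ N + 1) where

  2e : ℕ
  2e = e + e

  e<2e : e < 2e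
  e<2e = m<m+n e 1≤e

  k*e≤N : k * e ≤ N
  k*e≤N = +-cancelʳ-≤ 1 (k * e) N (begin
    k * e + 1               ≤⟨ +-monoʳ-≤ (k * e) (*-mono-≤ 1≤k 1≤e) ⟩
    k * e + k * e           ≡⟨ *-distribˡ-+ k e e ⟨
    k * 2e                  ≤⟨ m≤m+n (k * 2e) (s + s) ⟩
    k * 2e + (s + s)        ≡⟨ N+1≡2ek+2s ⟨
    N + 1                   ∎)
    where open ≤-Reasoning

  e≤N : e ≤ N
  e≤N = ≤-trans (subst (_≤ k * e) (*-identityˡ e) (*-monoˡ-≤ e 1≤k)) k*e≤N

  instance
    e-nonZero : NonZero e
    e-nonZero = >-nonZero 1≤e
    2e-nonZero : NonZero 2e
    2e-nonZero = >-nonZero (≤-trans 1≤e (m≤m+n e e))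
    N-nonZero : NonZero N
    N-nonZero = >-nonZero (≤-trans 1≤e e≤N)

  open Residues N
  open Layout s k 2e N N+1≡2ek+2s

  k∸1<k : k ∸ 1 < k
  k∸1<k = ≤-reflexive (m+[n∸m]≡n 1≤k)

  e∸1<e : e ∸ 1 < e
  e∸1<e = ≤-reflexive (m+[n∸m]≡n 1≤e)

  ∞ : ℕ
  ∞ = N

  N≤n : N ≤ n
  N≤n = +-cancelʳ-≤ 1 N n (subst (_≤ n + 1) n+s≡N+1 (+-monoʳ-≤ n s≤1))

  <n⇒<N : ∀ {u} → u < n → u ≢ ∞ → u < N
  <n⇒<N {u} u<n u≢∞ = ≤∧≢⇒< (+-cancelʳ-≤ 1 u N (begin
    u + 1     ≡⟨ +-comm u 1 ⟩
    suc u     ≤⟨ u<n ⟩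
    n         ≤⟨ m≤m+n n s ⟩
    n + s     ≡⟨ n+s≡N+1 ⟩
    N + 1     ∎)) u≢∞
    where open ≤-Reasoning

  ∞<n⇒s≡0 : ∞ < n → s ≡ 0
  ∞<n⇒s≡0 N<n = n≤0⇒n≡0 (+-cancelˡ-≤ n s 0 (begin
    n + s     ≡⟨ n+s≡N+1 ⟩
    N + 1     ≡⟨ +-comm N 1 ⟩
    suc N     ≤⟨ N<n ⟩
    n         ≡⟨ +-identityʳ n ⟨
    n + 0     ∎))
    where open ≤-Reasoning

  s≡0⇒∞<n : s ≡ 0 → ∞ < n
  s≡0⇒∞<n refl = ≤-reflexive (begin
    suc N     ≡⟨ +-comm 1 N ⟩
    N + 1     ≡⟨ n+s≡N+1 ⟨
    n + 0     ≡⟨ +-identityʳ n ⟩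
    n         ∎)
    where open ≡-Reasoning

  leafDiff : ℕ → ℕ → ℕ
  leafDiff j t = pos j (e + t)

  e+t<2e : ∀ {t} → t < e → e + t < 2e
  e+t<2e t<e = +-monoʳ-< e t<e

  row-leafDiff : ∀ j {t} → t < e → row (leafDiff j t) ≡ j
  row-leafDiff j t<e = row-pos j (e+t<2e t<e)

  column-leafDiff : ∀ j {t} → t < e → column (leafDiff j t) ≡ e + t
  column-leafDiff j t<e = column-pos j (e+t<2e t<e)

  s≤leafDiff : ∀ j t → s ≤ leafDiff j t
  s≤leafDiff j t = m≤m+n s _

  0<leafDiff : ∀ j t → 0 < leafDiff j t
  0<leafDiff j t =
    ≤-trans 1≤e (≤-trans (m≤m+n e t) (≤-trans (m≤n+m (e + t) (j * 2e)) (m≤n+m _ s)))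

  leafDiff≤N : ∀ {j t} → j < k → t < e → leafDiff j t ≤ N
  leafDiff≤N j<k t<e = pos≤N j<k (e+t<2e t<e)

  leafDiff-injective : ∀ j {t₁ t₂} → leafDiff j t₁ ≡ leafDiff j t₂ → t₁ ≡ t₂
  leafDiff-injective j = +-cancelˡ-≡ e _ _ ∘ +-cancelˡ-≡ (j * 2e) _ _ ∘ +-cancelˡ-≡ s _ _

  leafDiff≮N⇒s≡0∧j≡k∸1 : ∀ {j t} → j < k → t < e → ¬ leafDiff j t < N → s ≡ 0 × j ≡ k ∸ 1
  leafDiff≮N⇒s≡0∧j≡k∸1 {j} {t} j<k t<e leafDiff≮N = s≡0 , sym (cong (_∸ 1) k≡1+j)
    where
      a = k ∸ suc j
      b = 2e ∸ suc (e + t)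
      pos≡0 : pos a b ≡ 0
      pos≡0 = n≤0⇒n≡0 (+-cancelʳ-≤ (leafDiff j t) (pos a b) 0
                (subst (_≤ leafDiff j t) (sym (pos-mirror j<k (e+t<2e t<e))) (≮⇒≥ leafDiff≮N)))
      s≡0 : s ≡ 0
      s≡0 = m+n≡0⇒m≡0 s pos≡0
      a≡0 : a ≡ 0
      a≡0 = m*n≡0⇒m≡0 a 2e (m+n≡0⇒m≡0 (a * 2e) (m+n≡0⇒n≡0 s pos≡0))
      k≡1+j : k ≡ suc j
      k≡1+j = ≤-antisym (m∸n≡0⇒m≤n a≡0) j<k

  leafDiff≮N⇒≡N : ∀ {j t} → j < k → t < e → ¬ leafDiff j t < N → leafDiff j t ≡ N
  leafDiff≮N⇒≡N j<k t<e leafDiff≮N = ≤-antisym (leafDiff≤N j<k t<e) (≮⇒≥ leafDiff≮N)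

  leafDiff-last : s ≡ 0 → leafDiff (k ∸ 1) (e ∸ 1) ≡ N
  leafDiff-last refl =
    trans (cong (_+ leafDiff (k ∸ 1) (e ∸ 1)) (sym mirror≡0)) (pos-mirror k∸1<k (e+t<2e e∸1<e))
    where
      a≡0 : k ∸ suc (k ∸ 1) ≡ 0
      a≡0 = trans (cong (k ∸_) (m+[n∸m]≡n 1≤k)) (n∸n≡0 k)
      b≡0 : 2e ∸ suc (e + (e ∸ 1)) ≡ 0
      b≡0 = trans (cong (2e ∸_) (trans (sym (+-suc e (e ∸ 1))) (cong (e +_) (m+[n∸m]≡n 1≤e))))
                  (n∸n≡0 2e)
      mirror≡0 : pos (k ∸ suc (k ∸ 1)) (2e ∸ suc (e + (e ∸ 1))) ≡ 0
      mirror≡0 = cong₂ (λ a b → a * 2e + b) a≡0 b≡0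

  leafVertex : ℕ → ℕ → ℕ → ℕ
  leafVertex i j t with leafDiff j t <? N
  ... | yes _ = i +ₘ leafDiff j t
  ... | no _  = ∞

  leafVertex-< : ∀ {i j t} → leafDiff j t < N → leafVertex i j t ≡ i +ₘ leafDiff j t
  leafVertex-< {i} {j} {t} lt with leafDiff j t <? N
  ... | yes _ = refl
  ... | no ≮ = contradiction lt ≮

  leafVertex-last : s ≡ 0 → ∀ i → leafVertex i (k ∸ 1) (e ∸ 1) ≡ ∞
  leafVertex-last s≡0 i with leafDiff (k ∸ 1) (e ∸ 1) <? N
  ... | yes lt = contradiction (leafDiff-last s≡0) (<⇒≢ lt)
  ... | no _ = refl

  leafVertex<n : ∀ {i j t} → i < N → j < k → t < e → leafVertex i j t < n
  leafVertex<n {i} {j} {t} i<N j<k t<e with leafDiff j t <? N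
  ... | yes _ = <-≤-trans (+ₘ<N i _) N≤n
  ... | no ≮ = s≡0⇒∞<n (proj₁ (leafDiff≮N⇒s≡0∧j≡k∸1 j<k t<e ≮))

  leafVertex-injective : ∀ {i j t₁ t₂} → i < N → j < k → t₁ < e → t₂ < e →
                         leafVertex i j t₁ ≡ leafVertex i j t₂ → t₁ ≡ t₂
  leafVertex-injective {i} {j} {t₁} {t₂} i<N j<k t₁<e t₂<e eq
    with leafDiff j t₁ <? N | leafDiff j t₂ <? N
  ... | yes lt₁ | yes lt₂ = leafDiff-injective j (+ₘ-cancelˡ i (<⇒≤ i<N) lt₁ lt₂ eq)
  ... | yes _   | no _    = contradiction eq (<⇒≢ (+ₘ<N i _))
  ... | no _    | yes _   = contradiction (sym eq) (<⇒≢ (+ₘ<N i _))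
  ... | no ≮₁   | no ≮₂   =
    leafDiff-injective j (trans (leafDiff≮N⇒≡N j<k t₁<e ≮₁) (sym (leafDiff≮N⇒≡N j<k t₂<e ≮₂)))

  leafVertex≢centre : ∀ {i j t} → i < N → j < k → t < e → leafVertex i j t ≢ i
  leafVertex≢centre {i} {j} {t} i<N j<k t<e eq with leafDiff j t <? N
  ... | yes lt = >⇒≢ (0<leafDiff j t)
                   (+ₘ-cancelˡ i (<⇒≤ i<N) lt (>-nonZero⁻¹ N) (trans eq (sym (+ₘ-identityʳ i<N))))
  ... | no _ = <⇒≢ i<N (sym eq)

  LeafOf : ℕ → ℕ → ℕ → Set
  LeafOf i j x = ∃ λ t → t < e × leafVertex i j t ≡ x

  VertexOf : ℕ → ℕ → ℕ → Set
  VertexOf i j x = x ≡ i ⊎ LeafOf i j x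

  EdgeOf : ℕ → ℕ → ℕ → ℕ → Set
  EdgeOf i j u v = (u ≡ i × LeafOf i j v) ⊎ (v ≡ i × LeafOf i j u)

  -- v − u lies in the upper half of its row, so {u, v} belongs to a block centred at u.
  Outgoing : ℕ → ℕ → Set
  Outgoing u v = e ≤ column (v -ₘ u)

  outgoing? : ∀ u v → Dec (Outgoing u v)
  outgoing? u v = e ≤? column (v -ₘ u)

  outgoing⇒s≤ : ∀ u v → Outgoing u v → s ≤ v -ₘ u
  outgoing⇒s≤ u v out = 0<column⇒s≤ (≤-trans 1≤e out)

  leafDiff-outgoing : ∀ j {t} → t < e → e ≤ column (leafDiff j t)
  leafDiff-outgoing j {t} t<e = subst (e ≤_) (sym (column-leafDiff j t<e)) (m≤m+n e t)

  2e∸1+c<e : ∀ {c} → e ≤ c → 2e ∸ suc c < e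
  2e∸1+c<e {c} e≤c = begin-strict
    2e ∸ suc c   ≤⟨ ∸-monoʳ-≤ 2e (s≤s e≤c) ⟩
    2e ∸ suc e   <⟨ ∸-monoʳ-< (n<1+n e) e<2e ⟩
    2e ∸ e       ≡⟨ m+n∸m≡n e e ⟩
    e            ∎
    where open ≤-Reasoning

  e≤2e∸1+c : ∀ {c} → c < e → e ≤ 2e ∸ suc c
  e≤2e∸1+c {c} c<e = begin
    e            ≡⟨ m+n∸m≡n e e ⟨
    2e ∸ e       ≤⟨ ∸-monoʳ-≤ 2e c<e ⟩
    2e ∸ suc c   ∎
    where open ≤-Reasoning

  outgoing-mirror : ∀ {d} → s ≤ d → d < N → column d < e → e ≤ column (N ∸ d)
  outgoing-mirror s≤d d<N c<e = subst (e ≤_) (sym (column-mirror s≤1 s≤d d<N)) (e≤2e∸1+c c<e)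

  incoming-mirror : ∀ {d} → s ≤ d → d < N → e ≤ column d → column (N ∸ d) < e
  incoming-mirror s≤d d<N e≤c = subst (_< e) (sym (column-mirror s≤1 s≤d d<N)) (2e∸1+c<e e≤c)

  outgoing-reverse : ∀ {u v} → u < N → v < N → u ≢ v → ¬ Outgoing u v → Outgoing v u
  outgoing-reverse {u} {v} u<N v<N u≢v ¬out =
    subst (λ x → e ≤ column x) (sym u-ₘv≡N∸d) (outgoing-mirror s≤d (-ₘ<N v u) (≰⇒> ¬out))
    where
      d = v -ₘ u
      u+d≡v : u +ₘ d ≡ v
      u+d≡v = m+ₘ[n-ₘm]≡n (<⇒≤ u<N) v<N
      0<d : 0 < d
      0<d = n≢0⇒n>0 λ d≡0 →
        u≢v (trans (sym (+ₘ-identityʳ u<N)) (trans (cong (u +ₘ_) (sym d≡0)) u+d≡v))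
      s≤d : s ≤ d
      s≤d = ≤-trans s≤1 0<d
      u-ₘv≡N∸d : u -ₘ v ≡ N ∸ d
      u-ₘv≡N∸d = trans (cong (u -ₘ_) (sym u+d≡v)) (m-ₘ[m+ₘn]≡N∸n u<N 0<d (<⇒≤ (-ₘ<N v u)))

  outgoing⇒row<k : ∀ u v → Outgoing u v → row (v -ₘ u) < k
  outgoing⇒row<k u v out = row<k s≤1 (outgoing⇒s≤ u v out) (-ₘ<N v u)

  outgoing⇒leaf : ∀ {u v} → u < N → v < N → Outgoing u v → LeafOf u (row (v -ₘ u)) v
  outgoing⇒leaf {u} {v} u<N v<N out = column d ∸ e , t<e , (begin
    leafVertex u (row d) t    ≡⟨ leafVertex-< (subst (_< N) (sym leafDiff≡d) (-ₘ<N v u)) ⟩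
    u +ₘ leafDiff (row d) t   ≡⟨ cong (u +ₘ_) leafDiff≡d ⟩
    u +ₘ d                    ≡⟨ m+ₘ[n-ₘm]≡n (<⇒≤ u<N) v<N ⟩
    v                         ∎)
    where
      open ≡-Reasoning
      d = v -ₘ u
      t = column d ∸ e
      t<e : t < e
      t<e = subst (t <_) (m+n∸m≡n e e) (∸-monoˡ-< (column<E d) out)
      leafDiff≡d : leafDiff (row d) t ≡ d
      leafDiff≡d = trans (cong (pos (row d)) (m+[n∸m]≡n out)) (pos-row-column (outgoing⇒s≤ u v out))

  blockOf : ℕ → ℕ → ℕ × ℕ
  blockOf u v with u ≟ ∞ | v ≟ ∞ | outgoing? u v
  ... | yes _ | _     | _     = v , k ∸ 1
  ... | no _  | yes _ | _     = u , k ∸ 1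
  ... | no _  | no _  | yes _ = u , row (v -ₘ u)
  ... | no _  | no _  | no _  = v , row (u -ₘ v)

  blockOf-∞ˡ : ∀ v → blockOf ∞ v ≡ (v , k ∸ 1)
  blockOf-∞ˡ v with ∞ ≟ ∞ | v ≟ ∞ | outgoing? ∞ v
  ... | yes _  | _ | _ = refl
  ... | no ∞≢∞ | _ | _ = contradiction refl ∞≢∞

  blockOf-∞ʳ : ∀ {u} → u ≢ ∞ → blockOf u ∞ ≡ (u , k ∸ 1)
  blockOf-∞ʳ {u} u≢∞ with u ≟ ∞ | ∞ ≟ ∞ | outgoing? u ∞
  ... | yes u≡∞ | _      | _ = contradiction u≡∞ u≢∞
  ... | no _    | yes _  | _ = refl
  ... | no _    | no ∞≢∞ | _ = contradiction refl ∞≢∞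

  blockOf-outgoing : ∀ {u v} → u ≢ ∞ → v ≢ ∞ → Outgoing u v → blockOf u v ≡ (u , row (v -ₘ u))
  blockOf-outgoing {u} {v} u≢∞ v≢∞ out with u ≟ ∞ | v ≟ ∞ | outgoing? u v
  ... | yes u≡∞ | _       | _      = contradiction u≡∞ u≢∞
  ... | no _    | yes v≡∞ | _      = contradiction v≡∞ v≢∞
  ... | no _    | no _    | yes _  = refl
  ... | no _    | no _    | no ¬out = contradiction out ¬out

  blockOf-incoming : ∀ {u v} → u ≢ ∞ → v ≢ ∞ → ¬ Outgoing u v → blockOf u v ≡ (v , row (u -ₘ v))
  blockOf-incoming {u} {v} u≢∞ v≢∞ ¬out with u ≟ ∞ | v ≟ ∞ | outgoing? u v
  ... | yes u≡∞ | _       | _       = contradiction u≡∞ u≢∞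
  ... | no _    | yes v≡∞ | _       = contradiction v≡∞ v≢∞
  ... | no _    | no _    | yes out = contradiction out ¬out
  ... | no _    | no _    | no _    = refl

  blockOf-contains-edge : ∀ {u v} → u < n → v < n → u ≢ v →
                          ∃₂ λ i j → blockOf u v ≡ (i , j) × i < N × j < k × EdgeOf i j u v
  blockOf-contains-edge {u} {v} u<n v<n u≢v with u ≟ ∞ | v ≟ ∞ | outgoing? u v
  ... | yes refl | _ | _ =
    v , k ∸ 1 , refl , <n⇒<N v<n (u≢v ∘ sym) , k∸1<k ,
    inj₂ (refl , e ∸ 1 , e∸1<e , leafVertex-last (∞<n⇒s≡0 u<n) v)
  ... | no u≢∞ | yes refl | _ =
    u , k ∸ 1 , refl , <n⇒<N u<n u≢∞ , k∸1<k ,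
    inj₁ (refl , e ∸ 1 , e∸1<e , leafVertex-last (∞<n⇒s≡0 v<n) u)
  ... | no u≢∞ | no v≢∞ | yes out =
    u , row (v -ₘ u) , refl , u<N , outgoing⇒row<k u v out , inj₁ (refl , outgoing⇒leaf u<N v<N out)
    where
      u<N = <n⇒<N u<n u≢∞
      v<N = <n⇒<N v<n v≢∞
  ... | no u≢∞ | no v≢∞ | no ¬out =
    v , row (u -ₘ v) , refl , v<N , outgoing⇒row<k v u out′ , inj₂ (refl , outgoing⇒leaf v<N u<N out′)
    where
      u<N = <n⇒<N u<n u≢∞
      v<N = <n⇒<N v<n v≢∞
      out′ = outgoing-reverse u<N v<N u≢v ¬out

  row-[m+ₘleafDiff]-ₘm : ∀ {i j t} → i < N → t < e → leafDiff j t < N →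
                         row ((i +ₘ leafDiff j t) -ₘ i) ≡ j
  row-[m+ₘleafDiff]-ₘm {j = j} i<N t<e lt =
    trans (cong row ([m+ₘn]-ₘm≡n (<⇒≤ i<N) lt)) (row-leafDiff j t<e)

  blockOf-centre-leaf : ∀ {i j t} → i < N → j < k → t < e → blockOf i (leafVertex i j t) ≡ (i , j)
  blockOf-centre-leaf {i} {j} {t} i<N j<k t<e with leafDiff j t <? N
  ... | no ≮ =
    trans (blockOf-∞ʳ (<⇒≢ i<N)) (cong (i ,_) (sym (proj₂ (leafDiff≮N⇒s≡0∧j≡k∸1 j<k t<e ≮))))
  ... | yes lt = trans (blockOf-outgoing (<⇒≢ i<N) (<⇒≢ (+ₘ<N i _)) out)
                       (cong (i ,_) (row-[m+ₘleafDiff]-ₘm i<N t<e lt))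
    where
      out : Outgoing i (i +ₘ leafDiff j t)
      out = subst (λ x → e ≤ column x) (sym ([m+ₘn]-ₘm≡n (<⇒≤ i<N) lt)) (leafDiff-outgoing j t<e)

  blockOf-leaf-centre : ∀ {i j t} → i < N → j < k → t < e → blockOf (leafVertex i j t) i ≡ (i , j)
  blockOf-leaf-centre {i} {j} {t} i<N j<k t<e with leafDiff j t <? N
  ... | no ≮ =
    trans (blockOf-∞ˡ i) (cong (i ,_) (sym (proj₂ (leafDiff≮N⇒s≡0∧j≡k∸1 j<k t<e ≮))))
  ... | yes lt = trans (blockOf-incoming (<⇒≢ (+ₘ<N i _)) (<⇒≢ i<N) ¬out)
                       (cong (i ,_) (row-[m+ₘleafDiff]-ₘm i<N t<e lt))
    where
      column<e : column (N ∸ leafDiff j t) < e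
      column<e = incoming-mirror (s≤leafDiff j t) lt (leafDiff-outgoing j t<e)
      ¬out : ¬ Outgoing (i +ₘ leafDiff j t) i
      ¬out out = <⇒≱ column<e (subst (λ x → e ≤ column x)
                   (m-ₘ[m+ₘn]≡N∸n i<N (0<leafDiff j t) (<⇒≤ lt)) out)

  blockOf-unique : ∀ {i j u v} → i < N → j < k → EdgeOf i j u v → blockOf u v ≡ (i , j)
  blockOf-unique i<N j<k (inj₁ (refl , t , t<e , refl)) = blockOf-centre-leaf i<N j<k t<e
  blockOf-unique i<N j<k (inj₂ (refl , t , t<e , refl)) = blockOf-leaf-centre i<N j<k t<e

  colour : ℕ → ℕ → ℕ
  colour i j = i +ₘ suc j * e

  -- For a block of colour c, x − c is below N − ke at its leaves and at least N − ke at its centre.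
  rowOfOffset : ℕ → ℕ
  rowOfOffset r with r <? N ∸ k * e
  ... | yes _ = (r ∸ s) / e
  ... | no _  = (N ∸ r) / e ∸ 1

  rowOfOffset-< : ∀ {r} → r < N ∸ k * e → rowOfOffset r ≡ (r ∸ s) / e
  rowOfOffset-< {r} lt with r <? N ∸ k * e
  ... | yes _ = refl
  ... | no ≮ = contradiction lt ≮

  rowOfOffset-≥ : ∀ {r} → N ∸ k * e ≤ r → rowOfOffset r ≡ (N ∸ r) / e ∸ 1
  rowOfOffset-≥ {r} ge with r <? N ∸ k * e
  ... | yes lt = contradiction ge (<⇒≱ lt)
  ... | no _ = refl

  decodeRow : ℕ → ℕ → ℕ
  decodeRow c x with x ≟ ∞
  ... | yes _ = k ∸ 1
  ... | no _  = rowOfOffset (x -ₘ c)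

  decodeRow-∞ : ∀ c → decodeRow c ∞ ≡ k ∸ 1
  decodeRow-∞ c with ∞ ≟ ∞
  ... | yes _ = refl
  ... | no ∞≢∞ = contradiction refl ∞≢∞

  decodeRow-finite : ∀ {c x} → x ≢ ∞ → decodeRow c x ≡ rowOfOffset (x -ₘ c)
  decodeRow-finite {c} {x} x≢∞ with x ≟ ∞
  ... | yes x≡∞ = contradiction x≡∞ x≢∞
  ... | no _ = refl

  decodeRow-centre : ∀ {i j} → i < N → j < k → decodeRow (colour i j) i ≡ j
  decodeRow-centre {i} {j} i<N j<k = begin
    decodeRow (colour i j) i          ≡⟨ decodeRow-finite (<⇒≢ i<N) ⟩
    rowOfOffset (i -ₘ colour i j)     ≡⟨ cong rowOfOffset (m-ₘ[m+ₘn]≡N∸n i<N 0<shift shift≤N) ⟩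
    rowOfOffset (N ∸ suc j * e)       ≡⟨ rowOfOffset-≥ (∸-monoʳ-≤ N shift≤ke) ⟩
    (N ∸ (N ∸ suc j * e)) / e ∸ 1     ≡⟨ cong (λ x → x / e ∸ 1) (m∸[m∸n]≡n shift≤N) ⟩
    suc j * e / e ∸ 1                 ≡⟨ cong (_∸ 1) (m*n/n≡m (suc j) e) ⟩
    j                                 ∎
    where
      open ≡-Reasoning
      0<shift : 0 < suc j * e
      0<shift = ≤-trans 1≤e (m≤m+n e (j * e))
      shift≤ke : suc j * e ≤ k * e
      shift≤ke = *-monoˡ-≤ e j<k
      shift≤N : suc j * e ≤ N
      shift≤N = ≤-trans shift≤ke k*e≤N

  leafOffset<threshold : ∀ {j t} → j < k → t < e → leafDiff j t < N → s + (j * e + t) < N ∸ k * e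
  leafOffset<threshold {j} {t} j<k t<e lt = m+n≤o⇒m≤o∸n (suc r) (begin-strict
    r + k * e                 <⟨ m<m+n (r + k * e) 0<Y ⟩
    r + k * e + Y             ≡⟨ cong (λ K → r + K * e + Y) (m+[n∸m]≡n j<k) ⟨
    r + (suc j + a) * e + Y   ≡⟨ regroup s j a e t b ⟩
    X + leafDiff j t          ≡⟨ pos-mirror j<k (e+t<2e t<e) ⟩
    N                         ∎)
    where
      open ≤-Reasoning
      r = s + (j * e + t)
      a = k ∸ suc j
      b = 2e ∸ suc (e + t)
      X = pos a b
      Y = s + (a * e + b)
      regroup : ∀ s j a e t b → (s + (j * e + t)) + (suc j + a) * e + (s + (a * e + b))
                              ≡ (s + (a * (e + e) + b)) + (s + (j * (e + e) + (e + t)))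
      regroup = solve-∀
      Y+Y≡X+[s+b] : ∀ s a e b →
                    (s + (a * e + b)) + (s + (a * e + b)) ≡ (s + (a * (e + e) + b)) + (s + b)
      Y+Y≡X+[s+b] = solve-∀
      X≢0 : X ≢ 0
      X≢0 X≡0 = <⇒≢ lt (trans (cong (_+ leafDiff j t) (sym X≡0)) (pos-mirror j<k (e+t<2e t<e)))
      0<Y : 0 < Y
      0<Y = n≢0⇒n>0 λ Y≡0 →
        X≢0 (m+n≡0⇒m≡0 X (trans (sym (Y+Y≡X+[s+b] s a e b)) (cong (λ y → y + y) Y≡0)))

  decodeRow-leaf : ∀ {i j t} → i < N → j < k → t < e → decodeRow (colour i j) (leafVertex i j t) ≡ j
  decodeRow-leaf {i} {j} {t} i<N j<k t<e with leafDiff j t <? N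
  ... | no ≮ = trans (decodeRow-∞ (colour i j)) (sym (proj₂ (leafDiff≮N⇒s≡0∧j≡k∸1 j<k t<e ≮)))
  ... | yes lt = begin
    decodeRow (colour i j) (i +ₘ leafDiff j t)        ≡⟨ decodeRow-finite (<⇒≢ (+ₘ<N i _)) ⟩
    rowOfOffset ((i +ₘ leafDiff j t) -ₘ colour i j)   ≡⟨ cong rowOfOffset offset≡r ⟩
    rowOfOffset r                                     ≡⟨ rowOfOffset-< r<threshold ⟩
    (r ∸ s) / e                                       ≡⟨ cong (_/ e) (m+n∸m≡n s (j * e + t)) ⟩
    (j * e + t) / e                                   ≡⟨ [m*n+o]/n≡m j e t<e ⟩
    j                                                 ∎
    where
      open ≡-Reasoning
      r = s + (j * e + t)
      r<threshold = leafOffset<threshold j<k t<e lt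
      shift+r≡leafDiff : ∀ e j s t → suc j * e + (s + (j * e + t)) ≡ s + (j * (e + e) + (e + t))
      shift+r≡leafDiff = solve-∀
      offset≡r : (i +ₘ leafDiff j t) -ₘ colour i j ≡ r
      offset≡r = -ₘ-unique (<⇒≤ (+ₘ<N i _)) (<-≤-trans r<threshold (m∸n≤m N (k * e)))
                   (trans (+ₘ-assoc i (suc j * e) r) (cong (i +ₘ_) (shift+r≡leafDiff e j s t)))

  decodeRow-vertex : ∀ {i j x} → i < N → j < k → VertexOf i j x → decodeRow (colour i j) x ≡ j
  decodeRow-vertex i<N j<k (inj₁ refl) = decodeRow-centre i<N j<k
  decodeRow-vertex i<N j<k (inj₂ (t , t<e , refl)) = decodeRow-leaf i<N j<k t<e

  colour-separates : ∀ {i j i′ j′ x} → i < N → j < k → i′ < N → j′ < k →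
                     colour i j ≡ colour i′ j′ → VertexOf i j x → VertexOf i′ j′ x → (i , j) ≡ (i′ , j′)
  colour-separates {i} {j} {i′} {j′} {x} i<N j<k i′<N j′<k same x∈B x∈B′ =
    cong₂ _,_ i≡i′ j≡j′
    where
      j≡j′ : j ≡ j′
      j≡j′ = trans (sym (decodeRow-vertex i<N j<k x∈B))
               (trans (cong (λ c → decodeRow c x) same) (decodeRow-vertex i′<N j′<k x∈B′))
      i≡i′ : i ≡ i′
      i≡i′ = +ₘ-cancelʳ (suc j * e) i<N i′<N (trans same (cong (colour i′) (sym j≡j′)))

  colour-surjective : ∀ {y} → y < N → colour (y +ₘ (N ∸ e)) 0 ≡ y
  colour-surjective {y} y<N = begin
    (y +ₘ (N ∸ e)) +ₘ 1 * e           ≡⟨ cong ((y +ₘ (N ∸ e)) +ₘ_) (*-identityˡ e) ⟩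
    (y +ₘ (N ∸ e)) +ₘ e               ≡⟨ cong ((y +ₘ (N ∸ e)) +ₘ_) (m∸[m∸n]≡n e≤N) ⟨
    (y +ₘ (N ∸ e)) +ₘ (N ∸ (N ∸ e))   ≡⟨ [m+ₘn]+ₘ[N∸n]≡m y<N (m∸n≤m N e) ⟩
    y                                 ∎
    where open ≡-Reasoning

  star : Fin N × Fin k → Star n e
  star (i , j) = record
    { centre      = fromℕ< (<-≤-trans (toℕ<n i) N≤n)
    ; leaf        = λ t → fromℕ< (leafVertex<n (toℕ<n i) (toℕ<n j) (toℕ<n t))
    ; leaf-inj    = λ {t₁} {t₂} eq → toℕ-injective
                      (leafVertex-injective (toℕ<n i) (toℕ<n j) (toℕ<n t₁) (toℕ<n t₂) (fromℕ<-injective _ _ _ _ eq))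
    ; leaf≢centre = λ t eq →
                      leafVertex≢centre (toℕ<n i) (toℕ<n j) (toℕ<n t) (fromℕ<-injective _ _ _ _ eq)
    }

  module _ {i : Fin N} {j : Fin k} where

    isCentre⇒ : ∀ {x} → x ≡ centre (star (i , j)) → toℕ x ≡ toℕ i
    isCentre⇒ refl = toℕ-fromℕ< _

    ⇒isCentre : ∀ {x} → toℕ x ≡ toℕ i → x ≡ centre (star (i , j))
    ⇒isCentre eq = toℕ-injective (trans eq (sym (toℕ-fromℕ< _)))

    isLeaf⇒ : ∀ {x} → IsLeaf (star (i , j)) x → LeafOf (toℕ i) (toℕ j) (toℕ x)
    isLeaf⇒ (t , refl) = toℕ t , toℕ<n t , sym (toℕ-fromℕ< _)

    ⇒isLeaf : ∀ {x} → LeafOf (toℕ i) (toℕ j) (toℕ x) → IsLeaf (star (i , j)) x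
    ⇒isLeaf (t , t<e , eq) = fromℕ< t<e , toℕ-injective (begin
      toℕ (fromℕ< _)                                    ≡⟨ toℕ-fromℕ< _ ⟩
      leafVertex (toℕ i) (toℕ j) (toℕ (fromℕ< t<e))     ≡⟨ cong (leafVertex (toℕ i) (toℕ j)) (toℕ-fromℕ< t<e) ⟩
      leafVertex (toℕ i) (toℕ j) t                      ≡⟨ eq ⟩
      toℕ _                                             ∎)
      where open ≡-Reasoning

    hasEdge⇒ : ∀ {u v} → HasEdge (star (i , j)) u v → EdgeOf (toℕ i) (toℕ j) (toℕ u) (toℕ v)
    hasEdge⇒ = Sum.map (Product.map isCentre⇒ isLeaf⇒) (Product.map isCentre⇒ isLeaf⇒)

    ⇒hasEdge : ∀ {u v} → EdgeOf (toℕ i) (toℕ j) (toℕ u) (toℕ v) → HasEdge (star (i , j)) u v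
    ⇒hasEdge = Sum.map (Product.map ⇒isCentre ⇒isLeaf) (Product.map ⇒isCentre ⇒isLeaf)

    isVertex⇒ : ∀ {x} → IsVertex (star (i , j)) x → VertexOf (toℕ i) (toℕ j) (toℕ x)
    isVertex⇒ = Sum.map isCentre⇒ isLeaf⇒

  indexedBlock : Fin (N * k) → Star n e
  indexedBlock b = star (remQuot k b)

  edge-partition : IsStarSystem n e (N * k) indexedBlock
  edge-partition u v u≢v with blockOf-contains-edge (toℕ<n u) (toℕ<n v) (u≢v ∘ toℕ-injective)
  ... | i , j , blockOf≡ij , i<N , j<k , edge = index , hasEdge , unique
    where
      p : Fin N × Fin k
      p = fromℕ< i<N , fromℕ< j<k
      index = combine (proj₁ p) (proj₂ p)
      p≡ij : pair-toℕ p ≡ (i , j)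
      p≡ij = cong₂ _,_ (toℕ-fromℕ< i<N) (toℕ-fromℕ< j<k)
      hasEdge : HasEdge (indexedBlock index) u v
      hasEdge = subst (λ q → HasEdge (star q) u v) (sym (remQuot-combine (proj₁ p) (proj₂ p)))
                  (⇒hasEdge (subst₂ (λ a b → EdgeOf a b (toℕ u) (toℕ v))
                                    (sym (toℕ-fromℕ< i<N)) (sym (toℕ-fromℕ< j<k)) edge))
      unique : ∀ b → HasEdge (indexedBlock b) u v → b ≡ index
      unique b b∋uv = remQuot-injective k (pair-toℕ-injective (begin
        pair-toℕ (remQuot k b)      ≡⟨ blockOf-unique (toℕ<n _) (toℕ<n _) (hasEdge⇒ b∋uv) ⟨
        blockOf (toℕ u) (toℕ v)     ≡⟨ blockOf≡ij ⟩
        (i , j)                     ≡⟨ p≡ij ⟨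
        pair-toℕ p                  ≡⟨ cong pair-toℕ (remQuot-combine (proj₁ p) (proj₂ p)) ⟨
        pair-toℕ (remQuot k index)  ∎))
        where open ≡-Reasoning

  starSystem : StarSystem n e
  starSystem = record { nblocks = N * k ; block = indexedBlock ; partition = edge-partition }

  colourOfBlock : Fin N × Fin k → Fin N
  colourOfBlock (i , j) = fromℕ< (+ₘ<N (toℕ i) (suc (toℕ j) * e))

  colouring : Fin (N * k) → Fin N
  colouring b = colourOfBlock (remQuot k b)

  colouring-surjective : Surjective _≡_ _≡_ colouring
  colouring-surjective y = b , λ { refl → colouring-b≡y }
    where
      y<N = toℕ<n y
      y+N∸e<N = +ₘ<N (toℕ y) (N ∸ e)
      i = fromℕ< y+N∸e<N
      b = combine i (fromℕ< 1≤k)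
      colouring-b≡y : colouring b ≡ y
      colouring-b≡y = trans (cong colourOfBlock (remQuot-combine i _)) (toℕ-injective (begin
        toℕ (colourOfBlock (i , fromℕ< 1≤k))   ≡⟨ toℕ-fromℕ< _ ⟩
        colour (toℕ i) (toℕ (fromℕ< 1≤k))       ≡⟨ cong₂ colour (toℕ-fromℕ< y+N∸e<N) (toℕ-fromℕ< 1≤k) ⟩
        colour (toℕ y +ₘ (N ∸ e)) 0             ≡⟨ colour-surjective y<N ⟩
        toℕ y                                   ∎))
        where open ≡-Reasoning

  colouring-proper : ∀ b b′ → b ≢ b′ → colouring b ≡ colouring b′ →
                     VertexDisjoint (indexedBlock b) (indexedBlock b′)
  colouring-proper b b′ b≢b′ same x x∈b x∈b′ =
    b≢b′ (remQuot-injective k (same-colour (remQuot k b) (remQuot k b′) same x∈b x∈b′))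
    where
      same-colour : ∀ p q → colourOfBlock p ≡ colourOfBlock q →
                    IsVertex (star p) x → IsVertex (star q) x → p ≡ q
      same-colour (i , j) (i′ , j′) eq x∈p x∈q = pair-toℕ-injective
        (colour-separates (toℕ<n i) (toℕ<n j) (toℕ<n i′) (toℕ<n j′) (fromℕ<-injective _ _ _ _ eq)
          (isVertex⇒ x∈p) (isVertex⇒ x∈q))

  colourable : BlockColourable starSystem N
  colourable = colouring , colouring-surjective , colouring-proper

2*e≡e+e : ∀ e → 2 * e ≡ e + e
2*e≡e+e e = cong (e +_) (+-identityʳ e)

quotient-positive : ∀ {m q d} → 0 < m → m ≡ q * d → 1 ≤ q
quotient-positive {q = zero} 0<m m≡0 = contradiction m≡0 (>⇒≢ 0<m)
quotient-positive {q = suc _} _ _ = s≤s z≤n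

1≤2*e : ∀ {e} → 1 ≤ e → 1 ≤ 2 * e
1≤2*e {e} 1≤e = ≤-trans 1≤e (m≤m+n e _)

colourable-if-2e∣n : ∀ {e n} → 1 ≤ e → 2 * e ≤ n → 2 * e ∣ n →
                     ∃ λ (S : StarSystem n e) → BlockColourable S (n ∸ 1)
colourable-if-2e∣n {e} {n} 1≤e 2e≤n (divides k n≡k*2e) = starSystem , colourable
  where
    1≤n = ≤-trans (1≤2*e 1≤e) 2e≤n
    N+1≡2ek : n ∸ 1 + 1 ≡ k * (e + e) + (0 + 0)
    N+1≡2ek = begin
      n ∸ 1 + 1           ≡⟨ m∸n+n≡m 1≤n ⟩
      n                   ≡⟨ n≡k*2e ⟩
      k * (2 * e)         ≡⟨ cong (k *_) (2*e≡e+e e) ⟩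
      k * (e + e)         ≡⟨ +-identityʳ _ ⟨
      k * (e + e) + 0     ∎
      where open ≡-Reasoning
    open Construction e k 0 (n ∸ 1) n 1≤e (quotient-positive 1≤n n≡k*2e) z≤n N+1≡2ek
                      (trans (+-identityʳ n) (sym (m∸n+n≡m 1≤n)))

colourable-if-2e∣n∸1 : ∀ {e n} → 1 ≤ e → 2 * e ≤ n → 2 * e ∣ n ∸ 1 →
                       ∃ λ (S : StarSystem n e) → BlockColourable S n
colourable-if-2e∣n∸1 {e} {n} 1≤e 2e≤n (divides k n∸1≡k*2e) = starSystem , colourable
  where
    1≤n = ≤-trans (1≤2*e 1≤e) 2e≤n
    1≤n∸1 : 1 ≤ n ∸ 1
    1≤n∸1 = ∸-monoˡ-≤ 1 (≤-trans (+-mono-≤ 1≤e 1≤e) (subst (_≤ n) (2*e≡e+e e) 2e≤n))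
    N+1≡2ek+2 : n + 1 ≡ k * (e + e) + (1 + 1)
    N+1≡2ek+2 = begin
      n + 1               ≡⟨ cong (_+ 1) (m∸n+n≡m 1≤n) ⟨
      n ∸ 1 + 1 + 1       ≡⟨ +-assoc (n ∸ 1) 1 1 ⟩
      n ∸ 1 + 2           ≡⟨ cong (_+ 2) (trans n∸1≡k*2e (cong (k *_) (2*e≡e+e e))) ⟩
      k * (e + e) + 2     ∎
      where open ≡-Reasoning
    open Construction e k 1 n n 1≤e (quotient-positive 1≤n∸1 n∸1≡k*2e) ≤-refl N+1≡2ek+2 refl

-- The construction needs only e ≥ 1.
corollary3p5 : (e n : ℕ) → 3 ≤ e → 2 * e ≤ n →
    (2 * e ∣ n ⊎ 2 * e ∣ n ∸ 1) →
    ∃ λ (S : StarSystem n e) → BlockColourable S (n ∸ 1) ⊎ BlockColourable S n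
corollary3p5 e n 3≤e 2e≤n = Sum.[ Product.map₂ inj₁ ∘ colourable-if-2e∣n 1≤e 2e≤n
                                 , Product.map₂ inj₂ ∘ colourable-if-2e∣n∸1 1≤e 2e≤n ]′
  where
    1≤e : 1 ≤ e
    1≤e = ≤-trans (s≤s z≤n) 3≤e
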